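{- Let $n\ge2$, $p\in(0,1)$, and let $(X_t^S)$, $(X_t^D)$ be the SARPZF and DARPZF Markov chains on $K_n$ with reversion probability $p$, with $X_t$ the number of blue vertices at time $t$, and let $q(n,b)=1-(1-\tfrac{b}{n-1})^b$. Then for any $1\le b\le n$ and $0\le k\le n$, $\mathbf{P}_b[X_1^S=k]$ equals both \[\sum_{i=\max\{b,k\}}^n\binom{n-b}{i-b}\binom{i}{k}(1-p)^kp^{i-k}q(n,b)^{i-b}(1-q(n,b))^{n-i}\] and \[\sum_{i=0}^{\min\{b,k\}}\binom{n-b}{k-i}\binom{b}{i}(1-p)^ip^{b-i}[(1-p)q(n,b)]^{k-i}[1-(1-p)q(n,b)]^{n-b-(k-i)}.\] Additionally, \[\mathbf{P}_b[X_1^D=k]=\mathbf{P}_b[X_1^S=k]-\binom{n}{k}p^{n-k}(1-p)^kq(n,b)^{n-b}+\delta_{nk}\,q(n,b)^{n-b},\] where $\delta$ is the Kronecker delta.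
   Context: On a graph with blue set $B$, SARPZF with reversion probability $p$: Phase 1: each blue vertex $u$ independently attempts to force each white neighbor $w$ with success probability $|N[u]\cap B|/\deg u$ ($N[u]$ closed neighborhood); a white vertex becomes blue if some attempt succeeds, giving $B'$. Phase 2: each vertex of $B'$ independently turns white with probability $p$. DARPZF is identical except no reversion when $B'$ is the whole vertex set. $\mathbf{P}_b$ denotes probability given $X_0=b$. Binomial coefficients with out-of-range arguments are $0$ and $0^0=1$.
   Formalization: The reversion probability p ranges over the rationals in the interval (0,1). -}

module Defs where

open import Data.Nat as ℕ using (ℕ; zero; suc; _∸_; _≡ᵇ_)
open import Data.Nat.Combinatorics using (_C_)
open import Data.Integer using (+_)
open import Data.Rational using (ℚ; 0ℚ; 1ℚ; _+_; _*_; _-_; _/_)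
open import Data.Bool using (Bool; true; false; if_then_else_; _∧_; _∨_; not)
open import Data.Fin as Fin using (Fin)
open import Data.List using (List; []; _∷_; map; concatMap; foldr; upTo; allFin)
open import Data.Product using (_×_; _,_)
open import Relation.Nullary.Decidable using (⌊_⌋)

Dist : Set → Set
Dist A = List (A × ℚ)

return : {A : Set} → A → Dist A
return a = (a , 1ℚ) ∷ []

_>>=_ : {A B : Set} → Dist A → (A → Dist B) → Dist B
d >>= f = concatMap (λ { (a , r) → map (λ { (b , s) → (b , r * s) }) (f a) }) d

fmap : {A B : Set} → (A → B) → Dist A → Dist B
fmap g d = map (λ { (a , r) → (g a , r) }) d

bernoulli : ℚ → Dist Bool
bernoulli r = (true , r) ∷ (false , 1ℚ - r) ∷ []

consF : {A : Set} {n : ℕ} → A → (Fin n → A) → Fin (suc n) → A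
consF a g Fin.zero    = a
consF a g (Fin.suc i) = g i

indep : {A : Set} (n : ℕ) → (Fin n → Dist A) → Dist (Fin n → A)
indep zero    f = return (λ ())
indep (suc n) f = f Fin.zero >>= λ a → indep n (λ i → f (Fin.suc i)) >>= λ g → return (consF a g)

sumℚ : List ℚ → ℚ
sumℚ = foldr _+_ 0ℚ

Pr : {A : Set} → Dist A → (A → Bool) → ℚ
Pr d P = sumℚ (map (λ { (a , r) → if P a then r else 0ℚ }) d)

Graph : ℕ → Set
Graph n = Fin n → Fin n → Bool

complete : (n : ℕ) → Graph n
complete n i j = not ⌊ i Fin.≟ j ⌋

-- a colouring: true = blue, false = white
Colouring : ℕ → Set
Colouring n = Fin n → Bool

countF : {n : ℕ} → (Fin n → Bool) → ℕ
countF {n} P = foldr ℕ._+_ 0 (map (λ i → if P i then 1 else 0) (allFin n))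

anyF : {n : ℕ} → (Fin n → Bool) → Bool
anyF {n} P = foldr _∨_ false (map P (allFin n))

allF : {n : ℕ} → (Fin n → Bool) → Bool
allF {n} P = foldr _∧_ true (map P (allFin n))

deg : {n : ℕ} → Graph n → Fin n → ℕ
deg G u = countF (G u)

closedNbhdBlue : {n : ℕ} → Graph n → Colouring n → Fin n → ℕ
closedNbhdBlue G B u = countF (λ j → (⌊ j Fin.≟ u ⌋ ∨ G u j) ∧ B j)

-- forcing probability |N[u] ∩ B| / deg u  (deg u = 0 never matters:
-- such u has no white neighbour to force)
forceProb : {n : ℕ} → Graph n → Colouring n → Fin n → ℚ
forceProb G B u with deg G u
... | zero  = 0ℚ
... | suc d = + closedNbhdBlue G B u / suc d

phase1 : {n : ℕ} → Graph n → Colouring n → Dist (Colouring n)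
phase1 {n} G B = indep n λ w →
  if B w then return true
  else fmap anyF (indep n λ u →
         if B u ∧ G u w then bernoulli (forceProb G B u) else return false)

phase2 : {n : ℕ} → ℚ → Colouring n → Dist (Colouring n)
phase2 {n} p B' = indep n λ v →
  if B' v then fmap not (bernoulli p) else return false

stepS : {n : ℕ} → Graph n → ℚ → Colouring n → Dist (Colouring n)
stepS G p B = phase1 G B >>= phase2 p

stepD : {n : ℕ} → Graph n → ℚ → Colouring n → Dist (Colouring n)
stepD G p B = phase1 G B >>= λ B' → if allF B' then return B' else phase2 p B'

PrS : (n : ℕ) → ℚ → Colouring n → ℕ → ℚ
PrS n p B k = Pr (stepS (complete n) p B) (λ B₁ → countF B₁ ≡ᵇ k)

PrD : (n : ℕ) → ℚ → Colouring n → ℕ → ℚ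
PrD n p B k = Pr (stepD (complete n) p B) (λ B₁ → countF B₁ ≡ᵇ k)

_^ℚ_ : ℚ → ℕ → ℚ
r ^ℚ zero  = 1ℚ
r ^ℚ suc m = r * (r ^ℚ m)

binom : ℕ → ℕ → ℚ
binom a c = + (a C c) / 1

-- q(n,b) = 1 - (1 - b/(n-1))^b   (only used for n ≥ 2)
q : ℕ → ℕ → ℚ
q zero          b = 0ℚ
q (suc zero)    b = 0ℚ
q (suc (suc m)) b = 1ℚ - ((1ℚ - (+ b / suc m)) ^ℚ b)

-- Σ_{i = lo}^{hi} f i  (empty if hi < lo)
sumRange : ℕ → ℕ → (ℕ → ℚ) → ℚ
sumRange lo hi f = sumℚ (map (λ j → f (lo ℕ.+ j)) (upTo (suc hi ∸ lo)))

δ : ℕ → ℕ → ℚ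
δ a c = if a ≡ᵇ c then 1ℚ else 0ℚ

formula1 : ℕ → ℚ → ℕ → ℕ → ℚ
formula1 n p b k = sumRange (b ℕ.⊔ k) n λ i →
  binom (n ∸ b) (i ∸ b) * binom i k * ((1ℚ - p) ^ℚ k) * (p ^ℚ (i ∸ k))
  * (q n b ^ℚ (i ∸ b)) * ((1ℚ - q n b) ^ℚ (n ∸ i))

-- (when k - i > n - b the binomial vanishes, so truncated subtraction in
-- the last exponent is harmless)
formula2 : ℕ → ℚ → ℕ → ℕ → ℚ
formula2 n p b k = sumRange 0 (b ℕ.⊓ k) λ i →
  binom (n ∸ b) (k ∸ i) * binom b i * ((1ℚ - p) ^ℚ i) * (p ^ℚ (b ∸ i))
  * (((1ℚ - p) * q n b) ^ℚ (k ∸ i)) * ((1ℚ - (1ℚ - p) * q n b) ^ℚ ((n ∸ b) ∸ (k ∸ i)))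

module Submission where

-- On K_n every blue vertex forces with probability b/(n-1), so a white vertex escapes all b
-- independent attempts with probability (1 - b/(n-1))^b = 1 - q(n,b): Phase 1 turns the white
-- vertices blue independently, each with probability q. Composed with Phase 2, after one step the
-- vertices are independently blue with probability 1-p (if blue before) or (1-p)q (if white), so
-- the count is the convolution of Bin(b, 1-p) and Bin(n-b, (1-p)q), the second formula.
-- Conditioning instead on the number i of blue vertices after Phase 1, which is b + Bin(n-b, q),
-- Phase 2 leaves Bin(i, 1-p) of them blue, the first formula. DARPZF differs only on the event
-- i = n, of probability q^(n-b), where it keeps all n vertices blue instead of reverting.

open import Defs
open import Data.Nat using (ℕ; _≤_; _∸_)
open import Data.Rational using (ℚ; 0ℚ; 1ℚ; _<_; _+_; _*_; _-_)
open import Data.Product using (_×_)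
open import Relation.Binary.PropositionalEquality using (_≡_)

open import Data.Bool using (Bool; true; false; if_then_else_; not; _∧_; _∨_)
open import Data.Bool.Properties using (∨-zeroʳ)
open import Data.Empty using (⊥-elim)
open import Data.Fin as Fin using (Fin)
import Data.Integer as ℤ
import Data.Integer.Properties as ℤ
open import Data.List using ([]; _∷_; map; _++_; foldr; allFin; applyUpTo)
open import Data.List.Properties using (map-tabulate)
open import Data.Nat as ℕ using (zero; suc; _≡ᵇ_; z≤n; s≤s)
open import Data.Nat.Combinatorics using (_C_; nCk+nC[k+1]≡[n+1]C[k+1]; k>n⇒nCk≡0; nCn≡1)
import Data.Nat.Coprimality as Coprime
import Data.Nat.Properties as ℕ
open import Data.Product using (_,_; proj₁; proj₂)
open import Data.Rational using (mkℚ; _/_; -_)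
open import Data.Rational.Properties
  using (+-identityʳ; +-identityˡ; *-identityʳ; *-identityˡ; *-zeroʳ; *-zeroˡ; +-assoc; *-comm; ↥p/↧p≡p)
open import Data.Rational.Solver using (module +-*-Solver)
open import Function using (_∘_; id)
open import Relation.Binary.PropositionalEquality using (refl; sym; trans; cong; cong₂; subst; module ≡-Reasoning)
open import Relation.Nullary using (yes; no; Dec)
open import Relation.Nullary.Decidable using (⌊_⌋; dec-true; isYes≗does)
open +-*-Solver

private variable A B : Set

-- Expectations over finite distributions

𝔼 : Dist A → (A → ℚ) → ℚ
𝔼 []            φ = 0ℚ
𝔼 ((a , r) ∷ d) φ = r * φ a + 𝔼 d φ

𝟙 𝟙ᶜ : Bool → ℚ
𝟙  b = if b then 1ℚ else 0ℚ
𝟙ᶜ b = if b then 0ℚ else 1ℚ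

𝟙-not : ∀ x → 𝟙 (not x) ≡ 𝟙ᶜ x
𝟙-not true  = refl
𝟙-not false = refl

𝟙ᶜ-not : ∀ x → 𝟙ᶜ (not x) ≡ 𝟙 x
𝟙ᶜ-not true  = refl
𝟙ᶜ-not false = refl

Pr≡𝔼𝟙 : (d : Dist A) (P : A → Bool) → Pr d P ≡ 𝔼 d (𝟙 ∘ P)
Pr≡𝔼𝟙 []            P = refl
Pr≡𝔼𝟙 ((a , r) ∷ d) P = cong₂ _+_ (weight (P a)) (Pr≡𝔼𝟙 d P)
  where
  weight : ∀ b → (if b then r else 0ℚ) ≡ r * 𝟙 b
  weight true  = sym (*-identityʳ r)
  weight false = sym (*-zeroʳ r)

𝔼-cong : (d : Dist A) {φ ψ : A → ℚ} → (∀ a → φ a ≡ ψ a) → 𝔼 d φ ≡ 𝔼 d ψ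
𝔼-cong []            eq = refl
𝔼-cong ((a , r) ∷ d) eq = cong₂ _+_ (cong (r *_) (eq a)) (𝔼-cong d eq)

𝔼-++ : (d d′ : Dist A) (φ : A → ℚ) → 𝔼 (d ++ d′) φ ≡ 𝔼 d φ + 𝔼 d′ φ
𝔼-++ []            d′ φ = sym (+-identityˡ _)
𝔼-++ ((a , r) ∷ d) d′ φ =
  trans (cong (r * φ a +_) (𝔼-++ d d′ φ)) (sym (+-assoc (r * φ a) (𝔼 d φ) (𝔼 d′ φ)))

𝔼-+ : (d : Dist A) (φ ψ : A → ℚ) → 𝔼 d (λ a → φ a + ψ a) ≡ 𝔼 d φ + 𝔼 d ψ
𝔼-+ []            φ ψ = sym (+-identityʳ 0ℚ)
𝔼-+ ((a , r) ∷ d) φ ψ = trans (cong (r * (φ a + ψ a) +_) (𝔼-+ d φ ψ))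
  (solve 5 (λ r x y e f → r :* (x :+ y) :+ (e :+ f) := (r :* x :+ e) :+ (r :* y :+ f))
     refl r (φ a) (ψ a) (𝔼 d φ) (𝔼 d ψ))

𝔼-*ˡ : (d : Dist A) (c : ℚ) (φ : A → ℚ) → 𝔼 d (λ a → c * φ a) ≡ c * 𝔼 d φ
𝔼-*ˡ []            c φ = sym (*-zeroʳ c)
𝔼-*ˡ ((a , r) ∷ d) c φ = trans (cong (r * (c * φ a) +_) (𝔼-*ˡ d c φ))
  (solve 4 (λ r c x e → r :* (c :* x) :+ c :* e := c :* (r :* x :+ e)) refl r c (φ a) (𝔼 d φ))

𝔼-*ʳ : (d : Dist A) (c : ℚ) (φ : A → ℚ) → 𝔼 d (λ a → φ a * c) ≡ 𝔼 d φ * c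
𝔼-*ʳ d c φ = trans (𝔼-cong d (λ a → *-comm (φ a) c)) (trans (𝔼-*ˡ d c φ) (*-comm c _))

𝔼-0 : (d : Dist A) → 𝔼 d (λ _ → 0ℚ) ≡ 0ℚ
𝔼-0 []            = refl
𝔼-0 ((a , r) ∷ d) = trans (cong₂ _+_ (*-zeroʳ r) (𝔼-0 d)) (+-identityʳ 0ℚ)

𝔼-return : (a : A) (φ : A → ℚ) → 𝔼 (return a) φ ≡ φ a
𝔼-return a φ = trans (+-identityʳ _) (*-identityˡ _)

𝔼-fmap : (g : A → B) (d : Dist A) (φ : B → ℚ) → 𝔼 (fmap g d) φ ≡ 𝔼 d (φ ∘ g)
𝔼-fmap g []            φ = refl
𝔼-fmap g ((a , r) ∷ d) φ = cong (r * φ (g a) +_) (𝔼-fmap g d φ)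

𝔼-swap : (d : Dist A) (d′ : Dist B) (F : A → B → ℚ) →
         𝔼 d (λ a → 𝔼 d′ (F a)) ≡ 𝔼 d′ (λ b → 𝔼 d (λ a → F a b))
𝔼-swap []            d′ F = sym (𝔼-0 d′)
𝔼-swap ((a , r) ∷ d) d′ F = begin
    r * 𝔼 d′ (F a) + 𝔼 d (λ a → 𝔼 d′ (F a))
  ≡⟨ cong₂ _+_ (sym (𝔼-*ˡ d′ r (F a))) (𝔼-swap d d′ F) ⟩
    𝔼 d′ (λ b → r * F a b) + 𝔼 d′ (λ b → 𝔼 d (λ a → F a b))
  ≡⟨ sym (𝔼-+ d′ _ _) ⟩
    𝔼 d′ (λ b → r * F a b + 𝔼 d (λ a → F a b)) ∎
  where open ≡-Reasoning

𝔼->>= : (d : Dist A) (f : A → Dist B) (φ : B → ℚ) → 𝔼 (d >>= f) φ ≡ 𝔼 d (λ a → 𝔼 (f a) φ)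
𝔼->>= []            f φ = refl
𝔼->>= ((a , r) ∷ d) f φ =
  trans (𝔼-++ (map _ (f a)) _ φ) (cong₂ _+_ (𝔼-scaled (f a)) (𝔼->>= d f φ))
  where
  𝔼-scaled : ∀ d′ → 𝔼 (map (λ { (b , s) → (b , r * s) }) d′) φ ≡ r * 𝔼 d′ φ
  𝔼-scaled []            = sym (*-zeroʳ r)
  𝔼-scaled ((b , s) ∷ d′) = trans (cong ((r * s) * φ b +_) (𝔼-scaled d′))
    (solve 4 (λ r s x e → (r :* s) :* x :+ r :* e := r :* (s :* x :+ e)) refl r s (φ b) (𝔼 d′ φ))

𝔼->>=-return : (d : Dist A) (h : A → B) (φ : B → ℚ) →
               𝔼 (d >>= λ a → return (h a)) φ ≡ 𝔼 d (φ ∘ h)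
𝔼->>=-return d h φ = trans (𝔼->>= d (return ∘ h) φ) (𝔼-cong d (λ a → 𝔼-return (h a) φ))

𝔼-bool : (d : Dist Bool) (h : Bool → ℚ) → 𝔼 d h ≡ 𝔼 d 𝟙 * h true + 𝔼 d 𝟙ᶜ * h false
𝔼-bool d h = begin
    𝔼 d h
  ≡⟨ 𝔼-cong d split ⟩
    𝔼 d (λ a → 𝟙 a * h true + 𝟙ᶜ a * h false)
  ≡⟨ 𝔼-+ d _ _ ⟩
    𝔼 d (λ a → 𝟙 a * h true) + 𝔼 d (λ a → 𝟙ᶜ a * h false)
  ≡⟨ cong₂ _+_ (𝔼-*ʳ d (h true) 𝟙) (𝔼-*ʳ d (h false) 𝟙ᶜ) ⟩
    𝔼 d 𝟙 * h true + 𝔼 d 𝟙ᶜ * h false ∎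
  where
  open ≡-Reasoning
  split : ∀ a → h a ≡ 𝟙 a * h true + 𝟙ᶜ a * h false
  split true  = solve 2 (λ x y → x := con 1ℚ :* x :+ con 0ℚ :* y) refl (h true) (h false)
  split false = solve 2 (λ x y → y := con 0ℚ :* x :+ con 1ℚ :* y) refl (h true) (h false)

-- Counting over Fin

map-allFin-suc : {n : ℕ} (f : Fin (suc n) → A) →
                 map f (allFin (suc n)) ≡ f Fin.zero ∷ map (f ∘ Fin.suc) (allFin n)
map-allFin-suc f = cong (f Fin.zero ∷_) (trans (map-tabulate Fin.suc f) (sym (map-tabulate id (f ∘ Fin.suc))))

countF-suc : ∀ {n} (P : Fin (suc n) → Bool) →
             countF P ≡ (if P Fin.zero then 1 else 0) ℕ.+ countF (P ∘ Fin.suc)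
countF-suc P = cong (foldr ℕ._+_ 0) (map-allFin-suc (λ i → if P i then 1 else 0))

anyF-suc : ∀ {n} (P : Fin (suc n) → Bool) → anyF P ≡ (P Fin.zero ∨ anyF (P ∘ Fin.suc))
anyF-suc P = cong (foldr _∨_ false) (map-allFin-suc P)

allF-suc : ∀ {n} (P : Fin (suc n) → Bool) → allF P ≡ (P Fin.zero ∧ allF (P ∘ Fin.suc))
allF-suc P = cong (foldr _∧_ true) (map-allFin-suc P)

countF-cong : ∀ {n} {P Q : Fin n → Bool} → (∀ i → P i ≡ Q i) → countF P ≡ countF Q
countF-cong {zero}          eq = refl
countF-cong {suc n} {P} {Q} eq = begin
    countF P
  ≡⟨ countF-suc P ⟩
    (if P Fin.zero then 1 else 0) ℕ.+ countF (P ∘ Fin.suc)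
  ≡⟨ cong₂ (λ x y → (if x then 1 else 0) ℕ.+ y) (eq Fin.zero) (countF-cong (eq ∘ Fin.suc)) ⟩
    (if Q Fin.zero then 1 else 0) ℕ.+ countF (Q ∘ Fin.suc)
  ≡⟨ sym (countF-suc Q) ⟩
    countF Q ∎
  where open ≡-Reasoning

countF≤n : ∀ {n} (P : Fin n → Bool) → countF P ≤ n
countF≤n {zero}  P = z≤n
countF≤n {suc n} P rewrite countF-suc P with P Fin.zero
... | true  = s≤s (countF≤n (P ∘ Fin.suc))
... | false = ℕ.m≤n⇒m≤1+n (countF≤n (P ∘ Fin.suc))

countF-true : ∀ n → countF {n} (λ _ → true) ≡ n
countF-true zero    = refl
countF-true (suc n) = trans (countF-suc {n} (λ _ → true)) (cong suc (countF-true n))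

anyF≡countF≢0 : ∀ {n} (P : Fin n → Bool) → anyF P ≡ not (countF P ≡ᵇ 0)
anyF≡countF≢0 {zero}  P = refl
anyF≡countF≢0 {suc n} P rewrite anyF-suc P | countF-suc P with P Fin.zero
... | true  = refl
... | false = anyF≡countF≢0 (P ∘ Fin.suc)

≡ᵇ-refl : ∀ n → (n ≡ᵇ n) ≡ true
≡ᵇ-refl zero    = refl
≡ᵇ-refl (suc n) = ≡ᵇ-refl n

<⇒≡ᵇ≡false : ∀ {i n} → i ℕ.< n → (i ≡ᵇ n) ≡ false
<⇒≡ᵇ≡false {zero}  (s≤s z≤n)       = refl
<⇒≡ᵇ≡false {suc i} (s≤s (s≤s i<n)) = <⇒≡ᵇ≡false (s≤s i<n)

allF≡countF≡n : ∀ {n} (P : Fin n → Bool) → allF P ≡ (countF P ≡ᵇ n)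
allF≡countF≡n {zero}  P = refl
allF≡countF≡n {suc n} P rewrite allF-suc P | countF-suc P with P Fin.zero
... | true  = allF≡countF≡n (P ∘ Fin.suc)
... | false = sym (<⇒≡ᵇ≡false (s≤s (countF≤n (P ∘ Fin.suc))))

-- Finite sums

∑ : ℕ → (ℕ → ℚ) → ℚ
∑ zero    f = 0ℚ
∑ (suc N) f = f 0 + ∑ N (f ∘ suc)

sumRange≡∑ : ∀ lo hi f → sumRange lo hi f ≡ ∑ (suc hi ∸ lo) (λ j → f (lo ℕ.+ j))
sumRange≡∑ lo hi f = sum-applyUpTo (λ j → f (lo ℕ.+ j)) id (suc hi ∸ lo)
  where
  sum-applyUpTo : ∀ (g : ℕ → ℚ) (h : ℕ → ℕ) M → sumℚ (map g (applyUpTo h M)) ≡ ∑ M (g ∘ h)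
  sum-applyUpTo g h zero    = refl
  sum-applyUpTo g h (suc M) = cong (g (h 0) +_) (sum-applyUpTo g (h ∘ suc) M)

∑-cong : ∀ N {f g : ℕ → ℚ} → (∀ i → i ℕ.< N → f i ≡ g i) → ∑ N f ≡ ∑ N g
∑-cong zero    eq = refl
∑-cong (suc N) eq = cong₂ _+_ (eq 0 (s≤s z≤n)) (∑-cong N (λ i i<N → eq (suc i) (s≤s i<N)))

∑-0 : ∀ N (f : ℕ → ℚ) → (∀ i → i ℕ.< N → f i ≡ 0ℚ) → ∑ N f ≡ 0ℚ
∑-0 N f eq = trans (∑-cong N eq) (∑-const-0 N)
  where
  ∑-const-0 : ∀ N → ∑ N (λ _ → 0ℚ) ≡ 0ℚ
  ∑-const-0 zero    = refl
  ∑-const-0 (suc N) = trans (+-identityˡ _) (∑-const-0 N)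

∑-split : ∀ a c (f : ℕ → ℚ) → ∑ (a ℕ.+ c) f ≡ ∑ a f + ∑ c (λ j → f (a ℕ.+ j))
∑-split zero    c f = sym (+-identityˡ _)
∑-split (suc a) c f = trans (cong (f 0 +_) (∑-split a c (f ∘ suc))) (sym (+-assoc (f 0) _ _))

∑-drop-prefix : ∀ N lo (f : ℕ → ℚ) → lo ≤ N → (∀ i → i ℕ.< lo → f i ≡ 0ℚ) →
                ∑ N f ≡ ∑ (N ∸ lo) (λ j → f (lo ℕ.+ j))
∑-drop-prefix N lo f lo≤N zeros = begin
    ∑ N f                                    ≡⟨ cong (λ x → ∑ x f) (sym (ℕ.m+[n∸m]≡n lo≤N)) ⟩
    ∑ (lo ℕ.+ (N ∸ lo)) f                    ≡⟨ ∑-split lo (N ∸ lo) f ⟩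
    ∑ lo f + ∑ (N ∸ lo) (λ j → f (lo ℕ.+ j)) ≡⟨ cong (_+ ∑ (N ∸ lo) (λ j → f (lo ℕ.+ j))) (∑-0 lo f zeros) ⟩
    0ℚ + ∑ (N ∸ lo) (λ j → f (lo ℕ.+ j))     ≡⟨ +-identityˡ _ ⟩
    ∑ (N ∸ lo) (λ j → f (lo ℕ.+ j))          ∎
  where open ≡-Reasoning

∑-drop-suffix : ∀ N hi (f : ℕ → ℚ) → hi ≤ N → (∀ j → j ℕ.< N ∸ hi → f (hi ℕ.+ j) ≡ 0ℚ) → ∑ N f ≡ ∑ hi f
∑-drop-suffix N hi f hi≤N zeros = begin
    ∑ N f                                    ≡⟨ cong (λ x → ∑ x f) (sym (ℕ.m+[n∸m]≡n hi≤N)) ⟩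
    ∑ (hi ℕ.+ (N ∸ hi)) f                    ≡⟨ ∑-split hi (N ∸ hi) f ⟩
    ∑ hi f + ∑ (N ∸ hi) (λ j → f (hi ℕ.+ j)) ≡⟨ cong (∑ hi f +_) (∑-0 (N ∸ hi) _ zeros) ⟩
    ∑ hi f + 0ℚ                              ≡⟨ +-identityʳ _ ⟩
    ∑ hi f                                   ∎
  where open ≡-Reasoning

∑-snoc : ∀ N (f : ℕ → ℚ) → ∑ (suc N) f ≡ ∑ N f + f N
∑-snoc N f = begin
    ∑ (suc N) f             ≡⟨ cong (λ x → ∑ x f) (ℕ.+-comm 1 N) ⟩
    ∑ (N ℕ.+ 1) f           ≡⟨ ∑-split N 1 f ⟩
    ∑ N f + (f (N ℕ.+ 0) + 0ℚ) ≡⟨ cong (∑ N f +_) (trans (+-identityʳ _) (cong f (ℕ.+-identityʳ N))) ⟩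
    ∑ N f + f N             ∎
  where open ≡-Reasoning

∑-𝟙-≡ᵇ : ∀ (φ : ℕ → ℚ) n c → c ≤ n → φ c ≡ ∑ (suc n) (λ i → 𝟙 (c ≡ᵇ i) * φ i)
∑-𝟙-≡ᵇ φ n zero z≤n = sym (trans
  (cong₂ _+_ (*-identityˡ (φ 0)) (∑-0 n _ (λ i _ → *-zeroˡ (φ (suc i))))) (+-identityʳ _))
∑-𝟙-≡ᵇ φ (suc n) (suc c) (s≤s c≤n) = sym (trans
  (cong₂ _+_ (*-zeroˡ (φ 0)) (sym (∑-𝟙-≡ᵇ (φ ∘ suc) n c c≤n))) (+-identityˡ _))

-- Independent families and their number of successes

𝔼-indep-suc : ∀ n (f : Fin (suc n) → Dist A) (φ : (Fin (suc n) → A) → ℚ) →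
  𝔼 (indep (suc n) f) φ ≡ 𝔼 (f Fin.zero) (λ a → 𝔼 (indep n (f ∘ Fin.suc)) (φ ∘ consF a))
𝔼-indep-suc n f φ = trans (𝔼->>= (f Fin.zero) _ φ)
  (𝔼-cong (f Fin.zero) (λ a → 𝔼->>=-return (indep n (f ∘ Fin.suc)) (consF a) φ))

𝔼-indep->>= : ∀ n (f : Fin n → Dist A) (H : A → Dist B) (φ : (Fin n → B) → ℚ) →
  𝔼 (indep n f >>= λ g → indep n (H ∘ g)) φ ≡ 𝔼 (indep n (λ i → f i >>= H)) φ
𝔼-indep->>= zero    f H φ = refl
𝔼-indep->>= (suc n) f H φ = begin
    𝔼 (indep (suc n) f >>= λ g → indep (suc n) (H ∘ g)) φ
  ≡⟨ 𝔼->>= (indep (suc n) f) _ φ ⟩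
    𝔼 (indep (suc n) f) (λ g → 𝔼 (indep (suc n) (H ∘ g)) φ)
  ≡⟨ 𝔼-indep-suc n f _ ⟩
    𝔼 (f Fin.zero) (λ a → 𝔼 (indep n f′) (λ g → 𝔼 (indep (suc n) (H ∘ consF a g)) φ))
  ≡⟨ 𝔼-cong (f Fin.zero) (λ a → 𝔼-cong (indep n f′) (λ g → 𝔼-indep-suc n (H ∘ consF a g) φ)) ⟩
    𝔼 (f Fin.zero) (λ a → 𝔼 (indep n f′) (λ g → 𝔼 (H a) (λ b → 𝔼 (indep n (H ∘ g)) (φ ∘ consF b))))
  ≡⟨ 𝔼-cong (f Fin.zero) (λ a → 𝔼-swap (indep n f′) (H a) (λ g b → 𝔼 (indep n (H ∘ g)) (φ ∘ consF b))) ⟩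
    𝔼 (f Fin.zero) (λ a → 𝔼 (H a) (λ b → 𝔼 (indep n f′) (λ g → 𝔼 (indep n (H ∘ g)) (φ ∘ consF b))))
  ≡⟨ 𝔼-cong (f Fin.zero) (λ a → 𝔼-cong (H a) (λ b → sym (𝔼->>= (indep n f′) (λ g → indep n (H ∘ g)) (φ ∘ consF b)))) ⟩
    𝔼 (f Fin.zero) (λ a → 𝔼 (H a) (λ b → 𝔼 (indep n f′ >>= λ g → indep n (H ∘ g)) (φ ∘ consF b)))
  ≡⟨ 𝔼-cong (f Fin.zero) (λ a → 𝔼-cong (H a) (λ b → 𝔼-indep->>= n f′ H (φ ∘ consF b))) ⟩
    𝔼 (f Fin.zero) (λ a → 𝔼 (H a) (λ b → 𝔼 (indep n (λ i → f′ i >>= H)) (φ ∘ consF b)))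
  ≡⟨ sym (𝔼->>= (f Fin.zero) H _) ⟩
    𝔼 (f Fin.zero >>= H) (λ b → 𝔼 (indep n (λ i → f′ i >>= H)) (φ ∘ consF b))
  ≡⟨ sym (𝔼-indep-suc n (λ i → f i >>= H) φ) ⟩
    𝔼 (indep (suc n) (λ i → f i >>= H)) φ ∎
  where
  open ≡-Reasoning
  f′ = f ∘ Fin.suc

-- The weight σ i of "false" is kept apart from 1 - ρ i, so no normalisation of the coordinates is needed.
𝔼count : (n : ℕ) → (ρ σ : Fin n → ℚ) → (ℕ → ℚ) → ℚ
𝔼count zero    ρ σ φ = φ 0
𝔼count (suc n) ρ σ φ = ρ Fin.zero * 𝔼count n (ρ ∘ Fin.suc) (σ ∘ Fin.suc) (φ ∘ suc)
                     + σ Fin.zero * 𝔼count n (ρ ∘ Fin.suc) (σ ∘ Fin.suc) φ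

𝔼-indep-countF : ∀ n (f : Fin n → Dist Bool) (φ : ℕ → ℚ) →
  𝔼 (indep n f) (φ ∘ countF) ≡ 𝔼count n (λ i → 𝔼 (f i) 𝟙) (λ i → 𝔼 (f i) 𝟙ᶜ) φ
𝔼-indep-countF zero    f φ = 𝔼-return {Fin 0 → Bool} (λ ()) (φ ∘ countF)
𝔼-indep-countF (suc n) f φ = begin
    𝔼 (indep (suc n) f) (φ ∘ countF)
  ≡⟨ 𝔼-indep-suc n f _ ⟩
    𝔼 (f Fin.zero) (λ a → 𝔼 (indep n f′) (λ g → φ (countF (consF a g))))
  ≡⟨ 𝔼-cong (f Fin.zero) (λ a → 𝔼-cong (indep n f′) (λ g → cong φ (countF-suc (consF a g)))) ⟩
    𝔼 (f Fin.zero) (λ a → 𝔼 (indep n f′) (λ g → φ ((if a then 1 else 0) ℕ.+ countF g)))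
  ≡⟨ 𝔼-cong (f Fin.zero) (λ a → 𝔼-indep-countF n f′ (λ c → φ ((if a then 1 else 0) ℕ.+ c))) ⟩
    𝔼 (f Fin.zero) (λ a → 𝔼count n (λ i → 𝔼 (f′ i) 𝟙) (λ i → 𝔼 (f′ i) 𝟙ᶜ) (λ c → φ ((if a then 1 else 0) ℕ.+ c)))
  ≡⟨ 𝔼-bool (f Fin.zero) _ ⟩
    𝔼count (suc n) (λ i → 𝔼 (f i) 𝟙) (λ i → 𝔼 (f i) 𝟙ᶜ) φ ∎
  where
  open ≡-Reasoning
  f′ = f ∘ Fin.suc

𝔼count-congᶠ : ∀ n ρ σ {φ ψ : ℕ → ℚ} → (∀ c → c ≤ n → φ c ≡ ψ c) → 𝔼count n ρ σ φ ≡ 𝔼count n ρ σ ψ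
𝔼count-congᶠ zero    ρ σ eq = eq 0 z≤n
𝔼count-congᶠ (suc n) ρ σ eq = cong₂ _+_
  (cong (ρ Fin.zero *_) (𝔼count-congᶠ n _ _ (λ c c≤n → eq (suc c) (s≤s c≤n))))
  (cong (σ Fin.zero *_) (𝔼count-congᶠ n _ _ (λ c c≤n → eq c (ℕ.m≤n⇒m≤1+n c≤n))))

𝔼count-congʷ : ∀ n {ρ σ ρ′ σ′} (φ : ℕ → ℚ) → (∀ i → ρ i ≡ ρ′ i) → (∀ i → σ i ≡ σ′ i) →
               𝔼count n ρ σ φ ≡ 𝔼count n ρ′ σ′ φ
𝔼count-congʷ zero    φ eqρ eqσ = refl
𝔼count-congʷ (suc n) φ eqρ eqσ = cong₂ _+_
  (cong₂ _*_ (eqρ Fin.zero) (𝔼count-congʷ n _ (eqρ ∘ Fin.suc) (eqσ ∘ Fin.suc)))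
  (cong₂ _*_ (eqσ Fin.zero) (𝔼count-congʷ n _ (eqρ ∘ Fin.suc) (eqσ ∘ Fin.suc)))

𝔼count-0 : ∀ n ρ σ → 𝔼count n ρ σ (λ _ → 0ℚ) ≡ 0ℚ
𝔼count-0 zero    ρ σ = refl
𝔼count-0 (suc n) ρ σ = trans
  (cong₂ _+_ (cong (ρ Fin.zero *_) (𝔼count-0 n _ _)) (cong (σ Fin.zero *_) (𝔼count-0 n _ _)))
  (solve 2 (λ r s → r :* con 0ℚ :+ s :* con 0ℚ := con 0ℚ) refl (ρ Fin.zero) (σ Fin.zero))

𝔼count-+ : ∀ n ρ σ φ ψ → 𝔼count n ρ σ (λ c → φ c + ψ c) ≡ 𝔼count n ρ σ φ + 𝔼count n ρ σ ψ
𝔼count-+ zero    ρ σ φ ψ = refl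
𝔼count-+ (suc n) ρ σ φ ψ = trans
  (cong₂ _+_ (cong (ρ Fin.zero *_) (𝔼count-+ n _ _ _ _)) (cong (σ Fin.zero *_) (𝔼count-+ n _ _ _ _)))
  (solve 6 (λ r s a b c d → r :* (a :+ b) :+ s :* (c :+ d) := (r :* a :+ s :* c) :+ (r :* b :+ s :* d))
     refl (ρ Fin.zero) (σ Fin.zero) _ _ _ _)

𝔼count-*ʳ : ∀ n ρ σ φ x → 𝔼count n ρ σ (λ c → φ c * x) ≡ 𝔼count n ρ σ φ * x
𝔼count-*ʳ zero    ρ σ φ x = refl
𝔼count-*ʳ (suc n) ρ σ φ x = trans
  (cong₂ _+_ (cong (ρ Fin.zero *_) (𝔼count-*ʳ n _ _ _ x)) (cong (σ Fin.zero *_) (𝔼count-*ʳ n _ _ _ x)))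
  (solve 5 (λ r s a c x → r :* (a :* x) :+ s :* (c :* x) := (r :* a :+ s :* c) :* x)
     refl (ρ Fin.zero) (σ Fin.zero) _ _ x)

𝔼count-const : ∀ n ρ σ x → (∀ i → ρ i + σ i ≡ 1ℚ) → 𝔼count n ρ σ (λ _ → x) ≡ x
𝔼count-const zero    ρ σ x total = refl
𝔼count-const (suc n) ρ σ x total = begin
    ρ Fin.zero * 𝔼count n _ _ (λ _ → x) + σ Fin.zero * 𝔼count n _ _ (λ _ → x)
  ≡⟨ cong₂ (λ u v → ρ Fin.zero * u + σ Fin.zero * v) IH IH ⟩
    ρ Fin.zero * x + σ Fin.zero * x
  ≡⟨ solve 3 (λ r s x → r :* x :+ s :* x := (r :+ s) :* x) refl (ρ Fin.zero) (σ Fin.zero) x ⟩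
    (ρ Fin.zero + σ Fin.zero) * x
  ≡⟨ trans (cong (_* x) (total Fin.zero)) (*-identityˡ x) ⟩
    x ∎
  where
  open ≡-Reasoning
  IH = 𝔼count-const n (ρ ∘ Fin.suc) (σ ∘ Fin.suc) x (total ∘ Fin.suc)

𝔼count-𝟙ᶜ : ∀ n ρ σ (P : ℕ → Bool) → (∀ i → ρ i + σ i ≡ 1ℚ) →
            𝔼count n ρ σ (𝟙ᶜ ∘ P) ≡ 1ℚ - 𝔼count n ρ σ (𝟙 ∘ P)
𝔼count-𝟙ᶜ n ρ σ P total = begin
    𝔼count n ρ σ (𝟙ᶜ ∘ P)
  ≡⟨ 𝔼count-congᶠ n ρ σ (λ c _ → complement (P c)) ⟩
    𝔼count n ρ σ (λ c → 1ℚ + 𝟙 (P c) * (- 1ℚ))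
  ≡⟨ 𝔼count-+ n ρ σ _ _ ⟩
    𝔼count n ρ σ (λ _ → 1ℚ) + 𝔼count n ρ σ (λ c → 𝟙 (P c) * (- 1ℚ))
  ≡⟨ cong₂ _+_ (𝔼count-const n ρ σ 1ℚ total) (𝔼count-*ʳ n ρ σ (𝟙 ∘ P) (- 1ℚ)) ⟩
    1ℚ + 𝔼count n ρ σ (𝟙 ∘ P) * (- 1ℚ)
  ≡⟨ solve 1 (λ x → con 1ℚ :+ x :* (:- con 1ℚ) := con 1ℚ :- x) refl (𝔼count n ρ σ (𝟙 ∘ P)) ⟩
    1ℚ - 𝔼count n ρ σ (𝟙 ∘ P) ∎
  where
  open ≡-Reasoning
  complement : ∀ x → 𝟙ᶜ x ≡ 1ℚ + 𝟙 x * (- 1ℚ)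
  complement true  = refl
  complement false = refl

𝔼count-∑ : ∀ n ρ σ M (F : ℕ → ℕ → ℚ) → 𝔼count n ρ σ (λ c → ∑ M (λ i → F i c)) ≡ ∑ M (λ i → 𝔼count n ρ σ (F i))
𝔼count-∑ n ρ σ zero    F = 𝔼count-0 n ρ σ
𝔼count-∑ n ρ σ (suc M) F = trans (𝔼count-+ n ρ σ (F 0) (λ c → ∑ M (λ i → F (suc i) c)))
  (cong (𝔼count n ρ σ (F 0) +_) (𝔼count-∑ n ρ σ M (F ∘ suc)))

countPmf : (n : ℕ) → (ρ σ : Fin n → ℚ) → ℕ → ℚ
countPmf n ρ σ k = 𝔼count n ρ σ (λ c → 𝟙 (c ≡ᵇ k))

𝔼count≡∑countPmf : ∀ n ρ σ φ → 𝔼count n ρ σ φ ≡ ∑ (suc n) (λ i → countPmf n ρ σ i * φ i)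
𝔼count≡∑countPmf n ρ σ φ = begin
    𝔼count n ρ σ φ
  ≡⟨ 𝔼count-congᶠ n ρ σ (∑-𝟙-≡ᵇ φ n) ⟩
    𝔼count n ρ σ (λ c → ∑ (suc n) (λ i → 𝟙 (c ≡ᵇ i) * φ i))
  ≡⟨ 𝔼count-∑ n ρ σ (suc n) (λ i c → 𝟙 (c ≡ᵇ i) * φ i) ⟩
    ∑ (suc n) (λ i → 𝔼count n ρ σ (λ c → 𝟙 (c ≡ᵇ i) * φ i))
  ≡⟨ ∑-cong (suc n) (λ i _ → 𝔼count-*ʳ n ρ σ (λ c → 𝟙 (c ≡ᵇ i)) (φ i)) ⟩
    ∑ (suc n) (λ i → countPmf n ρ σ i * φ i) ∎
  where open ≡-Reasoning

-- Convolution and binomial distributions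

shift : (ℕ → ℚ) → ℕ → ℚ
shift A zero    = 0ℚ
shift A (suc j) = A j

shift-cong : ∀ {X Y : ℕ → ℚ} → (∀ j → X j ≡ Y j) → ∀ j → shift X j ≡ shift Y j
shift-cong eq zero    = refl
shift-cong eq (suc j) = eq j

shiftBy : ℕ → (ℕ → ℚ) → ℕ → ℚ
shiftBy zero    X = X
shiftBy (suc b) X = shift (shiftBy b X)

shiftBy-< : ∀ b X i → i ℕ.< b → shiftBy b X i ≡ 0ℚ
shiftBy-< (suc b) X zero    _         = refl
shiftBy-< (suc b) X (suc i) (s≤s i<b) = shiftBy-< b X i i<b

shiftBy-≥ : ∀ b X i → b ≤ i → shiftBy b X i ≡ X (i ∸ b)
shiftBy-≥ zero    X i       _         = refl
shiftBy-≥ (suc b) X (suc i) (s≤s b≤i) = shiftBy-≥ b X i b≤i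

conv : (ℕ → ℚ) → (ℕ → ℚ) → ℕ → ℚ
conv A X zero    = A 0 * X 0
conv A X (suc k) = A 0 * X (suc k) + conv (A ∘ suc) X k

conv≡∑ : ∀ (A X : ℕ → ℚ) k → conv A X k ≡ ∑ (suc k) (λ i → A i * X (k ∸ i))
conv≡∑ A X zero    = sym (+-identityʳ _)
conv≡∑ A X (suc k) = cong (A 0 * X (suc k) +_) (conv≡∑ (A ∘ suc) X k)

conv-cong : ∀ {A A′ X X′ : ℕ → ℚ} → (∀ i → A i ≡ A′ i) → (∀ i → X i ≡ X′ i) → ∀ k → conv A X k ≡ conv A′ X′ k
conv-cong eqA eqX zero    = cong₂ _*_ (eqA 0) (eqX 0)
conv-cong eqA eqX (suc k) = cong₂ _+_ (cong₂ _*_ (eqA 0) (eqX (suc k))) (conv-cong (eqA ∘ suc) eqX k)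

conv-linearˡ : ∀ a c (A A′ X : ℕ → ℚ) k → conv (λ i → a * A i + c * A′ i) X k ≡ a * conv A X k + c * conv A′ X k
conv-linearˡ a c A A′ X zero    =
  solve 5 (λ a c x y z → (a :* x :+ c :* y) :* z := a :* (x :* z) :+ c :* (y :* z)) refl a c (A 0) (A′ 0) (X 0)
conv-linearˡ a c A A′ X (suc k) = trans (cong ((a * A 0 + c * A′ 0) * X (suc k) +_) (conv-linearˡ a c _ _ X k))
  (solve 7 (λ a c x y z u v → (a :* x :+ c :* y) :* z :+ (a :* u :+ c :* v) := a :* (x :* z :+ u) :+ c :* (y :* z :+ v))
    refl a c (A 0) (A′ 0) (X (suc k)) (conv (A ∘ suc) X k) (conv (A′ ∘ suc) X k))

conv-linearʳ : ∀ a c (A X X′ : ℕ → ℚ) k → conv A (λ i → a * X i + c * X′ i) k ≡ a * conv A X k + c * conv A X′ k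
conv-linearʳ a c A X X′ zero    =
  solve 5 (λ a c x y z → z :* (a :* x :+ c :* y) := a :* (z :* x) :+ c :* (z :* y)) refl a c (X 0) (X′ 0) (A 0)
conv-linearʳ a c A X X′ (suc k) = trans (cong (A 0 * (a * X (suc k) + c * X′ (suc k)) +_) (conv-linearʳ a c _ X X′ k))
  (solve 7 (λ a c x y z u v → z :* (a :* x :+ c :* y) :+ (a :* u :+ c :* v) := a :* (z :* x :+ u) :+ c :* (z :* y :+ v))
    refl a c (X (suc k)) (X′ (suc k)) (A 0) (conv (A ∘ suc) X k) (conv (A ∘ suc) X′ k))

conv-shiftˡ : ∀ (A X : ℕ → ℚ) k → conv (shift A) X k ≡ shift (conv A X) k
conv-shiftˡ A X zero    = *-zeroˡ (X 0)
conv-shiftˡ A X (suc k) = trans (cong (_+ conv A X k) (*-zeroˡ (X (suc k)))) (+-identityˡ _)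

conv-shiftʳ : ∀ (A X : ℕ → ℚ) k → conv A (shift X) k ≡ shift (conv A X) k
conv-shiftʳ A X zero    = *-zeroʳ (A 0)
conv-shiftʳ A X (suc k) = go A k
  where
  go : ∀ A k → conv A (shift X) (suc k) ≡ conv A X k
  go A zero    = trans (cong (A 0 * X 0 +_) (*-zeroʳ (A 1))) (+-identityʳ _)
  go A (suc k) = cong (A 0 * X (suc k) +_) (go (A ∘ suc) k)

conv-0ˡ : ∀ (A X : ℕ → ℚ) → (∀ i → A i ≡ 0ℚ) → ∀ k → conv A X k ≡ 0ℚ
conv-0ˡ A X eq zero    = trans (cong (_* X 0) (eq 0)) (*-zeroˡ (X 0))
conv-0ˡ A X eq (suc k) = trans
  (cong₂ _+_ (trans (cong (_* X (suc k)) (eq 0)) (*-zeroˡ (X (suc k)))) (conv-0ˡ (A ∘ suc) X (eq ∘ suc) k))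
  (+-identityˡ 0ℚ)

conv-δʳ : ∀ (A X : ℕ → ℚ) → X 0 ≡ 1ℚ → (∀ j → X (suc j) ≡ 0ℚ) → ∀ k → conv A X k ≡ A k
conv-δʳ A X eq₀ eqₛ zero    = trans (cong (A 0 *_) eq₀) (*-identityʳ _)
conv-δʳ A X eq₀ eqₛ (suc k) = trans
  (cong₂ _+_ (trans (cong (A 0 *_) (eqₛ k)) (*-zeroʳ (A 0))) (conv-δʳ (A ∘ suc) X eq₀ eqₛ k))
  (+-identityˡ _)

conv-δˡ : ∀ (A X : ℕ → ℚ) → A 0 ≡ 1ℚ → (∀ j → A (suc j) ≡ 0ℚ) → ∀ k → conv A X k ≡ X k
conv-δˡ A X eq₀ eqₛ zero    = trans (cong (_* X 0) eq₀) (*-identityˡ _)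
conv-δˡ A X eq₀ eqₛ (suc k) = trans
  (cong₂ _+_ (trans (cong (_* X (suc k)) eq₀) (*-identityˡ (X (suc k)))) (conv-0ˡ (A ∘ suc) X eqₛ k))
  (+-identityʳ (X (suc k)))


binom-pascal : ∀ m j → binom (suc m) (suc j) ≡ binom m j + binom m (suc j)
binom-pascal m j = begin
    ℤ.+ (suc m C suc j) / 1
  ≡⟨ cong (λ x → ℤ.+ x / 1) (sym (nCk+nC[k+1]≡[n+1]C[k+1] m j)) ⟩
    ℤ.+ (a ℕ.+ c) / 1
  ≡⟨ cong (_/ 1) (cong₂ ℤ._+_ (sym (ℤ.*-identityʳ (ℤ.+ a))) (sym (ℤ.*-identityʳ (ℤ.+ c)))) ⟩
    fromℕ a + fromℕ c
  ≡⟨ sym (cong₂ _+_ (↥p/↧p≡p (fromℕ a)) (↥p/↧p≡p (fromℕ c))) ⟩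
    binom m j + binom m (suc j) ∎
  where
  open ≡-Reasoning
  a = m C j
  c = m C suc j
  fromℕ : ℕ → ℚ
  fromℕ x = mkℚ (ℤ.+ x) 0 (Coprime.sym (Coprime.1-coprimeTo x))

binom-> : ∀ m j → m ℕ.< j → binom m j ≡ 0ℚ
binom-> m j m<j = cong (λ x → ℤ.+ x / 1) (k>n⇒nCk≡0 m<j)

binom-diag : ∀ m → binom m m ≡ 1ℚ
binom-diag m = cong (λ x → ℤ.+ x / 1) (nCn≡1 m)

binPmf : ℕ → ℚ → ℚ → ℕ → ℚ
binPmf m s s̄ j = binom m j * (s ^ℚ j) * (s̄ ^ℚ (m ∸ j))

binPmf-> : ∀ m s s̄ j → m ℕ.< j → binPmf m s s̄ j ≡ 0ℚ
binPmf-> m s s̄ j m<j = trans (cong (λ x → x * (s ^ℚ j) * (s̄ ^ℚ (m ∸ j))) (binom-> m j m<j))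
  (trans (cong (_* (s̄ ^ℚ (m ∸ j))) (*-zeroˡ (s ^ℚ j))) (*-zeroˡ (s̄ ^ℚ (m ∸ j))))

binPmf-suc : ∀ m s s̄ j → binPmf (suc m) s s̄ j ≡ s * shift (binPmf m s s̄) j + s̄ * binPmf m s s̄ j
binPmf-suc m s s̄ zero    =
  solve 3 (λ s t x → con 1ℚ :* con 1ℚ :* (t :* x) := s :* con 0ℚ :+ t :* (con 1ℚ :* con 1ℚ :* x)) refl s s̄ (s̄ ^ℚ m)
binPmf-suc m s s̄ (suc j) with j ℕ.<? m
... | yes j<m = begin
    binom (suc m) (suc j) * (s * (s ^ℚ j)) * (s̄ ^ℚ (m ∸ j))
  ≡⟨ cong₂ (λ x y → x * (s * (s ^ℚ j)) * (s̄ ^ℚ y)) (binom-pascal m j) (m∸j≡1+m∸[1+j] j<m) ⟩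
    (binom m j + binom m (suc j)) * (s * (s ^ℚ j)) * (s̄ * (s̄ ^ℚ (m ∸ suc j)))
  ≡⟨ solve 6 (λ A B s S t Y → (A :+ B) :* (s :* S) :* (t :* Y) := s :* (A :* S :* (t :* Y)) :+ t :* (B :* (s :* S) :* Y))
       refl (binom m j) (binom m (suc j)) s (s ^ℚ j) s̄ (s̄ ^ℚ (m ∸ suc j)) ⟩
    s * (binom m j * (s ^ℚ j) * (s̄ * (s̄ ^ℚ (m ∸ suc j)))) + s̄ * binPmf m s s̄ (suc j)
  ≡⟨ cong (λ y → s * (binom m j * (s ^ℚ j) * (s̄ ^ℚ y)) + s̄ * binPmf m s s̄ (suc j)) (sym (m∸j≡1+m∸[1+j] j<m)) ⟩
    s * binPmf m s s̄ j + s̄ * binPmf m s s̄ (suc j) ∎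
  where
  open ≡-Reasoning
  m∸j≡1+m∸[1+j] : ∀ {j m} → j ℕ.< m → m ∸ j ≡ suc (m ∸ suc j)
  m∸j≡1+m∸[1+j] {zero}  {suc m} _         = refl
  m∸j≡1+m∸[1+j] {suc j} {suc m} (s≤s j<m) = m∸j≡1+m∸[1+j] j<m
... | no j≮m = begin
    binom (suc m) (suc j) * (s * (s ^ℚ j)) * (s̄ ^ℚ (m ∸ j))
  ≡⟨ cong (λ x → x * (s * (s ^ℚ j)) * (s̄ ^ℚ (m ∸ j)))
       (trans (binom-pascal m j) (cong (binom m j +_) binom≡0)) ⟩
    (binom m j + 0ℚ) * (s * (s ^ℚ j)) * (s̄ ^ℚ (m ∸ j))
  ≡⟨ solve 6 (λ A s S t Z W → (A :+ con 0ℚ) :* (s :* S) :* Z := s :* (A :* S :* Z) :+ t :* (con 0ℚ :* (s :* S) :* W))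
       refl (binom m j) s (s ^ℚ j) s̄ (s̄ ^ℚ (m ∸ j)) (s̄ ^ℚ (m ∸ suc j)) ⟩
    s * binPmf m s s̄ j + s̄ * (0ℚ * (s * (s ^ℚ j)) * (s̄ ^ℚ (m ∸ suc j)))
  ≡⟨ cong (λ x → s * binPmf m s s̄ j + s̄ * (x * (s * (s ^ℚ j)) * (s̄ ^ℚ (m ∸ suc j)))) (sym binom≡0) ⟩
    s * binPmf m s s̄ j + s̄ * binPmf m s s̄ (suc j) ∎
  where
  open ≡-Reasoning
  binom≡0 = binom-> m (suc j) (s≤s (ℕ.≮⇒≥ j≮m))

binPmf-0 : ∀ s s̄ j → binPmf 0 s s̄ (suc j) ≡ 0ℚ
binPmf-0 s s̄ j = binPmf-> 0 s s̄ (suc j) (s≤s z≤n)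

binPmf-degenerate : ∀ w → binPmf w 0ℚ 1ℚ 0 ≡ 1ℚ × (∀ j → binPmf w 0ℚ 1ℚ (suc j) ≡ 0ℚ)
binPmf-degenerate w = trans (*-identityˡ _) (1^ w) , λ j → trans
  (cong (λ x → binom w (suc j) * x * (1ℚ ^ℚ (w ∸ suc j))) (*-zeroˡ (0ℚ ^ℚ j)))
  (trans (cong (_* (1ℚ ^ℚ (w ∸ suc j))) (*-zeroʳ (binom w (suc j)))) (*-zeroˡ (1ℚ ^ℚ (w ∸ suc j))))
  where
  1^ : ∀ m → 1ℚ ^ℚ m ≡ 1ℚ
  1^ zero    = refl
  1^ (suc m) = trans (*-identityˡ _) (1^ m)

conv-binPmf-sucˡ : ∀ b s s̄ (X : ℕ → ℚ) j →
  conv (binPmf (suc b) s s̄) X j ≡ s * shift (conv (binPmf b s s̄) X) j + s̄ * conv (binPmf b s s̄) X j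
conv-binPmf-sucˡ b s s̄ X j = begin
    conv (binPmf (suc b) s s̄) X j
  ≡⟨ conv-cong (binPmf-suc b s s̄) (λ _ → refl) j ⟩
    conv (λ i → s * shift P i + s̄ * P i) X j
  ≡⟨ conv-linearˡ s s̄ (shift P) P X j ⟩
    s * conv (shift P) X j + s̄ * conv P X j
  ≡⟨ cong (λ x → s * x + s̄ * conv P X j) (conv-shiftˡ P X j) ⟩
    s * shift (conv P X) j + s̄ * conv P X j ∎
  where
  open ≡-Reasoning
  P = binPmf b s s̄

conv-binPmf-sucʳ : ∀ (A : ℕ → ℚ) w t t̄ j →
  conv A (binPmf (suc w) t t̄) j ≡ t * shift (conv A (binPmf w t t̄)) j + t̄ * conv A (binPmf w t t̄) j
conv-binPmf-sucʳ A w t t̄ j = begin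
    conv A (binPmf (suc w) t t̄) j
  ≡⟨ conv-cong (λ _ → refl) (binPmf-suc w t t̄) j ⟩
    conv A (λ i → t * shift X i + t̄ * X i) j
  ≡⟨ conv-linearʳ t t̄ A (shift X) X j ⟩
    t * conv A (shift X) j + t̄ * conv A X j
  ≡⟨ cong (λ x → t * x + t̄ * conv A X j) (conv-shiftʳ A X j) ⟩
    t * shift (conv A X) j + t̄ * conv A X j ∎
  where
  open ≡-Reasoning
  X = binPmf w t t̄

conv-binPmf-1-0 : ∀ b (X : ℕ → ℚ) i → conv (binPmf b 1ℚ 0ℚ) X i ≡ shiftBy b X i
conv-binPmf-1-0 zero    X i = conv-δˡ _ X refl (binPmf-0 1ℚ 0ℚ) i
conv-binPmf-1-0 (suc b) X i = begin
    conv (binPmf (suc b) 1ℚ 0ℚ) X i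
  ≡⟨ conv-binPmf-sucˡ b 1ℚ 0ℚ X i ⟩
    1ℚ * shift prev i + 0ℚ * prev i
  ≡⟨ solve 2 (λ x y → con 1ℚ :* x :+ con 0ℚ :* y := x) refl (shift prev i) (prev i) ⟩
    shift prev i
  ≡⟨ shift-cong (conv-binPmf-1-0 b X) i ⟩
    shiftBy (suc b) X i ∎
  where
  open ≡-Reasoning
  prev = conv (binPmf b 1ℚ 0ℚ) X

countPmf-suc : ∀ n ρ σ j → countPmf (suc n) ρ σ j ≡
  ρ Fin.zero * shift (countPmf n (ρ ∘ Fin.suc) (σ ∘ Fin.suc)) j + σ Fin.zero * countPmf n (ρ ∘ Fin.suc) (σ ∘ Fin.suc) j
countPmf-suc n ρ σ zero    = cong (λ x → ρ Fin.zero * x + σ Fin.zero * countPmf n (ρ ∘ Fin.suc) (σ ∘ Fin.suc) 0)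
                                  (𝔼count-0 n (ρ ∘ Fin.suc) (σ ∘ Fin.suc))
countPmf-suc n ρ σ (suc j) = refl

countPmf-two-valued : ∀ n (B : Fin n → Bool) {ρ σ : Fin n → ℚ} s s̄ t t̄ →
  (∀ i → ρ i ≡ (if B i then s else t)) → (∀ i → σ i ≡ (if B i then s̄ else t̄)) →
  ∀ j → countPmf n ρ σ j ≡ conv (binPmf (countF B) s s̄) (binPmf (n ∸ countF B) t t̄) j
countPmf-two-valued zero    B s s̄ t t̄ eqρ eqσ zero    = refl
countPmf-two-valued zero    B s s̄ t t̄ eqρ eqσ (suc j) = sym (trans
  (cong₂ _+_ (trans (cong (binPmf 0 s s̄ 0 *_) (binPmf-0 t t̄ j)) (*-zeroʳ (binPmf 0 s s̄ 0)))
             (conv-0ˡ (binPmf 0 s s̄ ∘ suc) (binPmf 0 t t̄) (binPmf-0 s s̄) j))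
  (+-identityˡ 0ℚ))
countPmf-two-valued (suc n) B {ρ} {σ} s s̄ t t̄ eqρ eqσ j = begin
    countPmf (suc n) ρ σ j
  ≡⟨ countPmf-suc n ρ σ j ⟩
    ρ Fin.zero * shift (countPmf n (ρ ∘ Fin.suc) (σ ∘ Fin.suc)) j + σ Fin.zero * countPmf n (ρ ∘ Fin.suc) (σ ∘ Fin.suc) j
  ≡⟨ cong₂ (λ x y → ρ Fin.zero * x + σ Fin.zero * y) (shift-cong IH j) (IH j) ⟩
    ρ Fin.zero * shift prev j + σ Fin.zero * prev j
  ≡⟨ by-colour (B Fin.zero) (eqρ Fin.zero) (eqσ Fin.zero) (countF-suc B) ⟩
    conv (binPmf (countF B) s s̄) (binPmf (suc n ∸ countF B) t t̄) j ∎
  where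
  open ≡-Reasoning
  B′ = B ∘ Fin.suc
  b′ = countF B′
  IH = countPmf-two-valued n B′ s s̄ t t̄ (eqρ ∘ Fin.suc) (eqσ ∘ Fin.suc)
  prev = conv (binPmf b′ s s̄) (binPmf (n ∸ b′) t t̄)
  by-colour : ∀ x {r r̄ c} → r ≡ (if x then s else t) → r̄ ≡ (if x then s̄ else t̄) → c ≡ (if x then 1 else 0) ℕ.+ b′ →
              r * shift prev j + r̄ * prev j ≡ conv (binPmf c s s̄) (binPmf (suc n ∸ c) t t̄) j
  by-colour true  refl refl refl = sym (conv-binPmf-sucˡ b′ s s̄ (binPmf (n ∸ b′) t t̄) j)
  by-colour false refl refl refl = trans (sym (conv-binPmf-sucʳ (binPmf b′ s s̄) (n ∸ b′) t t̄ j))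
    (cong (λ w → conv (binPmf b′ s s̄) (binPmf w t t̄) j) (sym (ℕ.+-∸-assoc 1 (countF≤n B′))))

-- Distributions on Bool, and Phase 2

Weights : Dist Bool → ℚ → ℚ → Set
Weights d r r̄ = 𝔼 d 𝟙 ≡ r × 𝔼 d 𝟙ᶜ ≡ r̄

bernoulli-weights : ∀ r → Weights (bernoulli r) r (1ℚ - r)
bernoulli-weights r =
    solve 1 (λ r → r :* con 1ℚ :+ ((con 1ℚ :- r) :* con 0ℚ :+ con 0ℚ) := r) refl r
  , solve 1 (λ r → r :* con 0ℚ :+ ((con 1ℚ :- r) :* con 1ℚ :+ con 0ℚ) := con 1ℚ :- r) refl r

not-bernoulli-weights : ∀ r → Weights (fmap not (bernoulli r)) (1ℚ - r) r
not-bernoulli-weights r =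
    solve 1 (λ r → r :* con 0ℚ :+ ((con 1ℚ :- r) :* con 1ℚ :+ con 0ℚ) := con 1ℚ :- r) refl r
  , solve 1 (λ r → r :* con 1ℚ :+ ((con 1ℚ :- r) :* con 0ℚ :+ con 0ℚ) := r) refl r

weights-≡ : ∀ d {r r̄ s s̄} → Weights d r r̄ → r ≡ s → r̄ ≡ s̄ → Weights d s s̄
weights-≡ d w refl refl = w

return-weights : ∀ x → Weights (return x) (𝟙 x) (𝟙ᶜ x)
return-weights x = 𝔼-return x 𝟙 , 𝔼-return x 𝟙ᶜ

>>=-weights : ∀ (d : Dist Bool) (H : Bool → Dist Bool) {r r̄ s s̄ t t̄} →
  Weights d r r̄ → Weights (H true) s s̄ → Weights (H false) t t̄ →
  Weights (d >>= H) (r * s + r̄ * t) (r * s̄ + r̄ * t̄)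
>>=-weights d H (d₁ , d₀) (t₁ , t₀) (f₁ , f₀) =
    weigh 𝟙 (cong₂ (λ x y → x * y) d₁ t₁) (cong₂ (λ x y → x * y) d₀ f₁)
  , weigh 𝟙ᶜ (cong₂ (λ x y → x * y) d₁ t₀) (cong₂ (λ x y → x * y) d₀ f₀)
  where
  weigh : ∀ φ {u v} → 𝔼 d 𝟙 * 𝔼 (H true) φ ≡ u → 𝔼 d 𝟙ᶜ * 𝔼 (H false) φ ≡ v → 𝔼 (d >>= H) φ ≡ u + v
  weigh φ eq₁ eq₀ = trans (𝔼->>= d H φ) (trans (𝔼-bool d (λ a → 𝔼 (H a) φ)) (cong₂ _+_ eq₁ eq₀))

𝔼𝟙-countF-indep : ∀ n (f : Fin n → Dist Bool) (B : Fin n → Bool) s s̄ t t̄ →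
  (∀ i → Weights (f i) (if B i then s else t) (if B i then s̄ else t̄)) →
  ∀ j → 𝔼 (indep n f) (λ g → 𝟙 (countF g ≡ᵇ j)) ≡ conv (binPmf (countF B) s s̄) (binPmf (n ∸ countF B) t t̄) j
𝔼𝟙-countF-indep n f B s s̄ t t̄ w j = trans (𝔼-indep-countF n f (λ c → 𝟙 (c ≡ᵇ j)))
  (countPmf-two-valued n B s s̄ t t̄ (proj₁ ∘ w) (proj₂ ∘ w) j)

phase2-at : ℚ → Bool → Dist Bool
phase2-at p a = if a then fmap not (bernoulli p) else return false

phase2-at-weights : ∀ p a → Weights (phase2-at p a) (if a then 1ℚ - p else 0ℚ) (if a then p else 1ℚ)
phase2-at-weights p true  = not-bernoulli-weights p
phase2-at-weights p false = return-weights false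

phase2-countF : ∀ n p (B′ : Colouring n) k →
  𝔼 (phase2 p B′) (λ g → 𝟙 (countF g ≡ᵇ k)) ≡ binPmf (countF B′) (1ℚ - p) p k
phase2-countF n p B′ k = trans
  (𝔼𝟙-countF-indep n (phase2-at p ∘ B′) B′ (1ℚ - p) p 0ℚ 1ℚ (phase2-at-weights p ∘ B′) k)
  (conv-δʳ (binPmf (countF B′) (1ℚ - p) p) (binPmf (n ∸ countF B′) 0ℚ 1ℚ) (proj₁ (binPmf-degenerate (n ∸ countF B′))) (proj₂ (binPmf-degenerate (n ∸ countF B′))) k)

-- The complete graph and Phase 1

degree-complete : ∀ N (u : Fin (suc N)) → deg (complete (suc N)) u ≡ N
degree-complete N       Fin.zero    = trans (countF-suc (complete (suc N) Fin.zero)) (countF-true N)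
degree-complete (suc N) (Fin.suc u) = trans (countF-suc (complete (suc (suc N)) (Fin.suc u)))
  (cong suc (trans (countF-cong (cong not ∘ ⌊suc≟suc⌋)) (degree-complete N u)))
  where
  ⌊suc≟suc⌋ : ∀ j → ⌊ Fin.suc u Fin.≟ Fin.suc j ⌋ ≡ ⌊ u Fin.≟ j ⌋
  ⌊suc≟suc⌋ j with u Fin.≟ j
  ... | yes _ = refl
  ... | no _  = refl

closedNbhdBlue-complete : ∀ {n} (B : Colouring n) u → closedNbhdBlue (complete n) B u ≡ countF B
closedNbhdBlue-complete B u = countF-cong in-closedNbhd
  where
  in-closedNbhd : ∀ j → ((⌊ j Fin.≟ u ⌋ ∨ not ⌊ u Fin.≟ j ⌋) ∧ B j) ≡ B j
  in-closedNbhd j with u Fin.≟ j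
  ... | yes refl = cong (λ x → (x ∨ false) ∧ B j) (trans (isYes≗does (j Fin.≟ j)) (dec-true (j Fin.≟ j) refl))
  ... | no _     = cong (_∧ B j) (∨-zeroʳ ⌊ j Fin.≟ u ⌋)

forceProb≡ : ∀ {n} (G : Graph n) (B : Colouring n) u {d c} →
             deg G u ≡ suc d → closedNbhdBlue G B u ≡ c → forceProb G B u ≡ ℤ.+ c / suc d
forceProb≡ G B u eq₁ eq₂ with deg G u | eq₁
... | _ | refl = cong (λ x → ℤ.+ x / _) eq₂

forceProb-complete : ∀ m (B : Colouring (suc (suc m))) u →
                     forceProb (complete (suc (suc m))) B u ≡ ℤ.+ countF B / suc m
forceProb-complete m B u = forceProb≡ (complete _) B u (degree-complete (suc m) u) (closedNbhdBlue-complete B u)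

-- phase1 G B and phase2 p B′ unfold to indep n (phase1-at G B) and indep n (phase2-at p ∘ B′).
attempt : ∀ {n} → Graph n → Colouring n → Fin n → Fin n → Dist Bool
attempt G B w u = if B u ∧ G u w then bernoulli (forceProb G B u) else return false

phase1-at : ∀ {n} → Graph n → Colouring n → Fin n → Dist Bool
phase1-at {n} G B w = if B w then return true else fmap anyF (indep n (attempt G B w))

module OnComplete (m : ℕ) (B : Colouring (suc (suc m))) where

  N : ℕ
  N = suc (suc m)
  G : Graph N
  G = complete N
  b : ℕ
  b = countF B
  r : ℚ
  r = ℤ.+ b / suc m

  blue-attempts-white : ∀ {w} → B w ≡ false → ∀ u → (B u ∧ G u w) ≡ B u
  blue-attempts-white {w} white u with B u in blue
  ... | false = refl
  ... | true with u Fin.≟ w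
  ...   | yes refl with () ← trans (sym blue) white
  ...   | no _ = refl

  attempt-weights : ∀ {w} → B w ≡ false → ∀ u →
    Weights (attempt G B w u) (if B u then r else 0ℚ) (if B u then 1ℚ - r else 1ℚ)
  attempt-weights {w} white u =
    subst (λ x → Weights (if x then bernoulli (forceProb G B u) else return false) _ _)
          (sym (blue-attempts-white white u)) (by-colour (B u))
    where
    by-colour : ∀ x → Weights (if x then bernoulli (forceProb G B u) else return false)
                              (if x then r else 0ℚ) (if x then 1ℚ - r else 1ℚ)
    by-colour true  = subst (λ s → Weights (bernoulli (forceProb G B u)) s (1ℚ - s))
                            (forceProb-complete m B u) (bernoulli-weights (forceProb G B u))
    by-colour false = return-weights false

  no-force : ∀ {w} → B w ≡ false → 𝔼 (indep N (attempt G B w)) (λ g → 𝟙 (countF g ≡ᵇ 0)) ≡ 1ℚ - q N b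
  no-force {w} white = begin
      𝔼 (indep N (attempt G B w)) (λ g → 𝟙 (countF g ≡ᵇ 0))
    ≡⟨ 𝔼𝟙-countF-indep N (attempt G B w) B r (1ℚ - r) 0ℚ 1ℚ (attempt-weights white) 0 ⟩
      conv (binPmf b r (1ℚ - r)) (binPmf (N ∸ b) 0ℚ 1ℚ) 0
    ≡⟨ conv-δʳ (binPmf b r (1ℚ - r)) (binPmf (N ∸ b) 0ℚ 1ℚ) (proj₁ (binPmf-degenerate (N ∸ b))) (proj₂ (binPmf-degenerate (N ∸ b))) 0 ⟩
      1ℚ * 1ℚ * ((1ℚ - r) ^ℚ b)
    ≡⟨ solve 1 (λ x → con 1ℚ :* con 1ℚ :* x := con 1ℚ :- (con 1ℚ :- x)) refl ((1ℚ - r) ^ℚ b) ⟩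
      1ℚ - q N b ∎
    where open ≡-Reasoning

  white-weights : ∀ {w} → B w ≡ false → Weights (fmap anyF (indep N (attempt G B w))) (q N b) (1ℚ - q N b)
  white-weights {w} white = forced , unforced
    where
    open ≡-Reasoning
    D = indep N (attempt G B w)
    ρ σ : Fin N → ℚ
    ρ u = 𝔼 (attempt G B w u) 𝟙
    σ u = 𝔼 (attempt G B w u) 𝟙ᶜ

    total : ∀ u → ρ u + σ u ≡ 1ℚ
    total u = trans (cong₂ _+_ (proj₁ (attempt-weights white u)) (proj₂ (attempt-weights white u))) (by-colour (B u))
      where
      by-colour : ∀ x → (if x then r else 0ℚ) + (if x then 1ℚ - r else 1ℚ) ≡ 1ℚ
      by-colour true  = solve 1 (λ r → r :+ (con 1ℚ :- r) := con 1ℚ) refl r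
      by-colour false = refl

    unforced : 𝔼 (fmap anyF D) 𝟙ᶜ ≡ 1ℚ - q N b
    unforced = begin
        𝔼 (fmap anyF D) 𝟙ᶜ
      ≡⟨ 𝔼-fmap anyF D 𝟙ᶜ ⟩
        𝔼 D (𝟙ᶜ ∘ anyF)
      ≡⟨ 𝔼-cong D (λ g → trans (cong 𝟙ᶜ (anyF≡countF≢0 g)) (𝟙ᶜ-not (countF g ≡ᵇ 0))) ⟩
        𝔼 D (λ g → 𝟙 (countF g ≡ᵇ 0))
      ≡⟨ no-force white ⟩
        1ℚ - q N b ∎

    forced : 𝔼 (fmap anyF D) 𝟙 ≡ q N b
    forced = begin
        𝔼 (fmap anyF D) 𝟙
      ≡⟨ 𝔼-fmap anyF D 𝟙 ⟩
        𝔼 D (𝟙 ∘ anyF)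
      ≡⟨ 𝔼-cong D (λ g → trans (cong 𝟙 (anyF≡countF≢0 g)) (𝟙-not (countF g ≡ᵇ 0))) ⟩
        𝔼 D (λ g → 𝟙ᶜ (countF g ≡ᵇ 0))
      ≡⟨ 𝔼-indep-countF N (attempt G B w) (λ c → 𝟙ᶜ (c ≡ᵇ 0)) ⟩
        𝔼count N ρ σ (λ c → 𝟙ᶜ (c ≡ᵇ 0))
      ≡⟨ 𝔼count-𝟙ᶜ N ρ σ (_≡ᵇ 0) total ⟩
        1ℚ - 𝔼count N ρ σ (λ c → 𝟙 (c ≡ᵇ 0))
      ≡⟨ cong (λ x → 1ℚ - x) (trans (sym (𝔼-indep-countF N (attempt G B w) (λ c → 𝟙 (c ≡ᵇ 0)))) (no-force white)) ⟩
        1ℚ - (1ℚ - q N b)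
      ≡⟨ solve 1 (λ x → con 1ℚ :- (con 1ℚ :- x) := x) refl (q N b) ⟩
        q N b ∎

  phase1-at-weights : ∀ w → Weights (phase1-at G B w) (if B w then 1ℚ else q N b) (if B w then 0ℚ else 1ℚ - q N b)
  phase1-at-weights w = by-colour (B w) refl
    where
    by-colour : ∀ x → B w ≡ x → Weights (if x then return true else fmap anyF (indep N (attempt G B w)))
                                        (if x then 1ℚ else q N b) (if x then 0ℚ else 1ℚ - q N b)
    by-colour true  _     = return-weights true
    by-colour false white = white-weights white

  phase1Binomial phase1Pmf : ℕ → ℚ
  phase1Binomial = binPmf (N ∸ b) (q N b) (1ℚ - q N b)
  phase1Pmf      = shiftBy b phase1Binomial

  phase1Pmf-top : phase1Pmf N ≡ q N b ^ℚ (N ∸ b)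
  phase1Pmf-top = begin
      phase1Pmf N
    ≡⟨ shiftBy-≥ b phase1Binomial N (countF≤n B) ⟩
      binom (N ∸ b) (N ∸ b) * (q N b ^ℚ (N ∸ b)) * ((1ℚ - q N b) ^ℚ ((N ∸ b) ∸ (N ∸ b)))
    ≡⟨ cong₂ (λ x e → x * (q N b ^ℚ (N ∸ b)) * ((1ℚ - q N b) ^ℚ e)) (binom-diag (N ∸ b)) (ℕ.n∸n≡0 (N ∸ b)) ⟩
      1ℚ * (q N b ^ℚ (N ∸ b)) * 1ℚ
    ≡⟨ solve 1 (λ x → con 1ℚ :* x :* con 1ℚ := x) refl (q N b ^ℚ (N ∸ b)) ⟩
      q N b ^ℚ (N ∸ b) ∎
    where open ≡-Reasoning

  𝔼-phase1-countF : ∀ (g : ℕ → ℚ) → 𝔼 (phase1 G B) (g ∘ countF) ≡ ∑ (suc N) (λ i → phase1Pmf i * g i)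
  𝔼-phase1-countF g = begin
      𝔼 (phase1 G B) (g ∘ countF)
    ≡⟨ 𝔼-indep-countF N (phase1-at G B) g ⟩
      𝔼count N ρ σ g
    ≡⟨ 𝔼count≡∑countPmf N ρ σ g ⟩
      ∑ (suc N) (λ i → countPmf N ρ σ i * g i)
    ≡⟨ ∑-cong (suc N) (λ i _ → cong (_* g i) (trans
         (countPmf-two-valued N B 1ℚ 0ℚ (q N b) (1ℚ - q N b) (λ w → proj₁ (phase1-at-weights w)) (λ w → proj₂ (phase1-at-weights w)) i)
         (conv-binPmf-1-0 b phase1Binomial i))) ⟩
      ∑ (suc N) (λ i → phase1Pmf i * g i) ∎
    where
    open ≡-Reasoning
    ρ σ : Fin N → ℚ
    ρ w = 𝔼 (phase1-at G B w) 𝟙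
    σ w = 𝔼 (phase1-at G B w) 𝟙ᶜ

  module _ (p : ℚ) (k : ℕ) where

    phase1-then-binomial : ℕ → ℚ
    phase1-then-binomial i = phase1Pmf i * binPmf i (1ℚ - p) p k

    PrS≡∑ : PrS N p B k ≡ ∑ (suc N) phase1-then-binomial
    PrS≡∑ = begin
        PrS N p B k
      ≡⟨ Pr≡𝔼𝟙 (stepS G p B) (λ g → countF g ≡ᵇ k) ⟩
        𝔼 (phase1 G B >>= phase2 p) (λ g → 𝟙 (countF g ≡ᵇ k))
      ≡⟨ 𝔼->>= (phase1 G B) (phase2 p) (λ g → 𝟙 (countF g ≡ᵇ k)) ⟩
        𝔼 (phase1 G B) (λ B′ → 𝔼 (phase2 p B′) (λ g → 𝟙 (countF g ≡ᵇ k)))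
      ≡⟨ 𝔼-cong (phase1 G B) (λ B′ → phase2-countF N p B′ k) ⟩
        𝔼 (phase1 G B) (λ B′ → binPmf (countF B′) (1ℚ - p) p k)
      ≡⟨ 𝔼-phase1-countF (λ i → binPmf i (1ℚ - p) p k) ⟩
        ∑ (suc N) phase1-then-binomial ∎
      where open ≡-Reasoning

    PrS≡formula1 : k ≤ N → PrS N p B k ≡ formula1 N p b k
    PrS≡formula1 k≤N = begin
        PrS N p B k
      ≡⟨ PrS≡∑ ⟩
        ∑ (suc N) phase1-then-binomial
      ≡⟨ ∑-drop-prefix (suc N) L phase1-then-binomial (ℕ.m≤n⇒m≤1+n (ℕ.⊔-lub (countF≤n B) k≤N)) below ⟩
        ∑ (suc N ∸ L) (λ j → phase1-then-binomial (L ℕ.+ j))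
      ≡⟨ ∑-cong (suc N ∸ L) (λ j _ → term (L ℕ.+ j) (ℕ.≤-trans (ℕ.m≤m⊔n b k) (ℕ.m≤m+n L j))) ⟩
        ∑ (suc N ∸ L) (λ j → F (L ℕ.+ j))
      ≡⟨ sym (sumRange≡∑ L N F) ⟩
        formula1 N p b k ∎
      where
      open ≡-Reasoning
      L = b ℕ.⊔ k
      F : ℕ → ℚ
      F i = binom (N ∸ b) (i ∸ b) * binom i k * ((1ℚ - p) ^ℚ k) * (p ^ℚ (i ∸ k))
            * (q N b ^ℚ (i ∸ b)) * ((1ℚ - q N b) ^ℚ (N ∸ i))

      below : ∀ i → i ℕ.< L → phase1-then-binomial i ≡ 0ℚ
      below i i<L = by-cases (i ℕ.<? b) (i ℕ.<? k)
        where
        by-cases : Dec (i ℕ.< b) → Dec (i ℕ.< k) → phase1-then-binomial i ≡ 0ℚ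
        by-cases (yes i<b) _         = trans (cong (_* binPmf i (1ℚ - p) p k) (shiftBy-< b phase1Binomial i i<b))
                                             (*-zeroˡ (binPmf i (1ℚ - p) p k))
        by-cases (no _)    (yes i<k) = trans (cong (phase1Pmf i *_) (binPmf-> i (1ℚ - p) p k i<k)) (*-zeroʳ (phase1Pmf i))
        by-cases (no i≮b)  (no i≮k)  = ⊥-elim (ℕ.≤⇒≯ (ℕ.⊔-lub (ℕ.≮⇒≥ i≮b) (ℕ.≮⇒≥ i≮k)) i<L)

      term : ∀ i → b ≤ i → phase1-then-binomial i ≡ F i
      term i b≤i = begin
          phase1Pmf i * binPmf i (1ℚ - p) p k
        ≡⟨ cong (_* binPmf i (1ℚ - p) p k) (shiftBy-≥ b phase1Binomial i b≤i) ⟩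
          binom (N ∸ b) (i ∸ b) * (q N b ^ℚ (i ∸ b)) * ((1ℚ - q N b) ^ℚ ((N ∸ b) ∸ (i ∸ b))) * binPmf i (1ℚ - p) p k
        ≡⟨ cong (λ e → binom (N ∸ b) (i ∸ b) * (q N b ^ℚ (i ∸ b)) * ((1ℚ - q N b) ^ℚ e) * binPmf i (1ℚ - p) p k)
             (trans (ℕ.∸-+-assoc N b (i ∸ b)) (cong (N ∸_) (ℕ.m+[n∸m]≡n b≤i))) ⟩
          binom (N ∸ b) (i ∸ b) * (q N b ^ℚ (i ∸ b)) * ((1ℚ - q N b) ^ℚ (N ∸ i)) * binPmf i (1ℚ - p) p k
        ≡⟨ solve 6 (λ C₁ Q R C₂ A P → C₁ :* Q :* R :* (C₂ :* A :* P) := C₁ :* C₂ :* A :* P :* Q :* R) refl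
             (binom (N ∸ b) (i ∸ b)) (q N b ^ℚ (i ∸ b)) ((1ℚ - q N b) ^ℚ (N ∸ i)) (binom i k) ((1ℚ - p) ^ℚ k) (p ^ℚ (i ∸ k)) ⟩
          F i ∎

    t t̄ : ℚ
    t = (1ℚ - p) * q N b
    t̄ = 1ℚ - (1ℚ - p) * q N b

    step-at-weights : ∀ w → Weights (phase1-at G B w >>= phase2-at p) (if B w then 1ℚ - p else t) (if B w then p else t̄)
    step-at-weights w = weights-≡ (phase1-at G B w >>= phase2-at p)
      (>>=-weights (phase1-at G B w) (phase2-at p) (phase1-at-weights w) (phase2-at-weights p true) (phase2-at-weights p false))
      (by-colour₁ (B w)) (by-colour₀ (B w))
      where
      by-colour₁ : ∀ x → (if x then 1ℚ else q N b) * (1ℚ - p) + (if x then 0ℚ else 1ℚ - q N b) * 0ℚ ≡ (if x then 1ℚ - p else t)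
      by-colour₁ true  = solve 1 (λ p → con 1ℚ :* (con 1ℚ :- p) :+ con 0ℚ :* con 0ℚ := con 1ℚ :- p) refl p
      by-colour₁ false = solve 2 (λ p q → q :* (con 1ℚ :- p) :+ (con 1ℚ :- q) :* con 0ℚ := (con 1ℚ :- p) :* q) refl p (q N b)
      by-colour₀ : ∀ x → (if x then 1ℚ else q N b) * p + (if x then 0ℚ else 1ℚ - q N b) * 1ℚ ≡ (if x then p else t̄)
      by-colour₀ true  = solve 1 (λ p → con 1ℚ :* p :+ con 0ℚ :* con 1ℚ := p) refl p
      by-colour₀ false = solve 2 (λ p q → q :* p :+ (con 1ℚ :- q) :* con 1ℚ := con 1ℚ :- (con 1ℚ :- p) :* q) refl p (q N b)

    PrS≡formula2 : PrS N p B k ≡ formula2 N p b k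
    PrS≡formula2 = begin
        PrS N p B k
      ≡⟨ Pr≡𝔼𝟙 (stepS G p B) (λ g → countF g ≡ᵇ k) ⟩
        𝔼 (phase1 G B >>= phase2 p) (λ g → 𝟙 (countF g ≡ᵇ k))
      ≡⟨ 𝔼-indep->>= N (phase1-at G B) (phase2-at p) (λ g → 𝟙 (countF g ≡ᵇ k)) ⟩
        𝔼 (indep N (λ w → phase1-at G B w >>= phase2-at p)) (λ g → 𝟙 (countF g ≡ᵇ k))
      ≡⟨ 𝔼𝟙-countF-indep N (λ w → phase1-at G B w >>= phase2-at p) B (1ℚ - p) p t t̄ step-at-weights k ⟩
        conv (binPmf b (1ℚ - p) p) (binPmf (N ∸ b) t t̄) k
      ≡⟨ conv≡∑ (binPmf b (1ℚ - p) p) (binPmf (N ∸ b) t t̄) k ⟩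
        ∑ (suc k) f
      ≡⟨ ∑-drop-suffix (suc k) (suc M) f (s≤s (ℕ.m⊓n≤n b k)) above ⟩
        ∑ (suc M) f
      ≡⟨ ∑-cong (suc M) (λ i _ → rearrange i) ⟩
        ∑ (suc M) F
      ≡⟨ sym (sumRange≡∑ 0 M F) ⟩
        formula2 N p b k ∎
      where
      open ≡-Reasoning
      M = b ℕ.⊓ k
      f F : ℕ → ℚ
      f i = binPmf b (1ℚ - p) p i * binPmf (N ∸ b) t t̄ (k ∸ i)
      F i = binom (N ∸ b) (k ∸ i) * binom b i * ((1ℚ - p) ^ℚ i) * (p ^ℚ (b ∸ i))
            * (t ^ℚ (k ∸ i)) * (t̄ ^ℚ ((N ∸ b) ∸ (k ∸ i)))

      above : ∀ j → j ℕ.< k ∸ M → f (suc M ℕ.+ j) ≡ 0ℚ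
      above j j<k∸M = by-cases (b ℕ.≤? k)
        where
        i = suc M ℕ.+ j
        by-cases : Dec (b ≤ k) → f i ≡ 0ℚ
        by-cases (yes b≤k) = trans (cong (_* binPmf (N ∸ b) t t̄ (k ∸ i)) (binPmf-> b (1ℚ - p) p i b<i))
                                   (*-zeroˡ (binPmf (N ∸ b) t t̄ (k ∸ i)))
          where
          b<i : b ℕ.< i
          b<i = ℕ.≤-trans (s≤s (ℕ.≤-reflexive (sym (ℕ.m≤n⇒m⊓n≡m b≤k)))) (ℕ.m≤m+n (suc M) j)
        by-cases (no b≰k)  = ⊥-elim (ℕ.≤⇒≯ z≤n (ℕ.≤-trans j<k∸M (ℕ.≤-reflexive k∸M≡0)))
          where
          k∸M≡0 : k ∸ M ≡ 0
          k∸M≡0 = trans (cong (k ∸_) (ℕ.m≥n⇒m⊓n≡n (ℕ.<⇒≤ (ℕ.≰⇒> b≰k)))) (ℕ.n∸n≡0 k)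

      rearrange : ∀ i → f i ≡ F i
      rearrange i = solve 6 (λ C₁ A P C₂ T U → C₁ :* A :* P :* (C₂ :* T :* U) := C₂ :* C₁ :* A :* P :* T :* U) refl
        (binom b i) ((1ℚ - p) ^ℚ i) (p ^ℚ (b ∸ i)) (binom (N ∸ b) (k ∸ i)) (t ^ℚ (k ∸ i)) (t̄ ^ℚ ((N ∸ b) ∸ (k ∸ i)))

    PrS≡∑<N : PrS N p B k ≡ ∑ N phase1-then-binomial + (q N b ^ℚ (N ∸ b)) * binPmf N (1ℚ - p) p k
    PrS≡∑<N = trans PrS≡∑ (trans (∑-snoc N phase1-then-binomial) (cong (λ x → ∑ N phase1-then-binomial + x * binPmf N (1ℚ - p) p k) phase1Pmf-top))

    PrD≡∑<N : PrD N p B k ≡ ∑ N phase1-then-binomial + (q N b ^ℚ (N ∸ b)) * δ N k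
    PrD≡∑<N = begin
        PrD N p B k
      ≡⟨ Pr≡𝔼𝟙 (stepD G p B) (λ g → countF g ≡ᵇ k) ⟩
        𝔼 (phase1 G B >>= revert) (λ g → 𝟙 (countF g ≡ᵇ k))
      ≡⟨ 𝔼->>= (phase1 G B) revert (λ g → 𝟙 (countF g ≡ᵇ k)) ⟩
        𝔼 (phase1 G B) (λ B′ → 𝔼 (revert B′) (λ g → 𝟙 (countF g ≡ᵇ k)))
      ≡⟨ 𝔼-cong (phase1 G B) revert-countF ⟩
        𝔼 (phase1 G B) (g ∘ countF)
      ≡⟨ 𝔼-phase1-countF g ⟩
        ∑ (suc N) (λ i → phase1Pmf i * g i)
      ≡⟨ ∑-snoc N (λ i → phase1Pmf i * g i) ⟩
        ∑ N (λ i → phase1Pmf i * g i) + phase1Pmf N * g N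
      ≡⟨ cong₂ _+_
           (∑-cong N (λ i i<N → cong (λ x → phase1Pmf i * (if x then 𝟙 (i ≡ᵇ k) else binPmf i (1ℚ - p) p k)) (<⇒≡ᵇ≡false i<N)))
           (cong₂ (λ x y → x * (if y then 𝟙 (N ≡ᵇ k) else binPmf N (1ℚ - p) p k)) phase1Pmf-top (≡ᵇ-refl N)) ⟩
        ∑ N phase1-then-binomial + (q N b ^ℚ (N ∸ b)) * δ N k ∎
      where
      open ≡-Reasoning
      revert : Colouring N → Dist (Colouring N)
      revert B′ = if allF B′ then return B′ else phase2 p B′
      g : ℕ → ℚ
      g c = if c ≡ᵇ N then 𝟙 (c ≡ᵇ k) else binPmf c (1ℚ - p) p k
      revert-countF : ∀ B′ → 𝔼 (revert B′) (λ g → 𝟙 (countF g ≡ᵇ k)) ≡ g (countF B′)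
      revert-countF B′ = trans (cong (λ x → 𝔼 (if x then return B′ else phase2 p B′) (λ g → 𝟙 (countF g ≡ᵇ k))) (allF≡countF≡n B′))
                               (by-cases (countF B′ ≡ᵇ N))
        where
        by-cases : ∀ x → 𝔼 (if x then return B′ else phase2 p B′) (λ g → 𝟙 (countF g ≡ᵇ k))
                         ≡ (if x then 𝟙 (countF B′ ≡ᵇ k) else binPmf (countF B′) (1ℚ - p) p k)
        by-cases true  = 𝔼-return B′ (λ g → 𝟙 (countF g ≡ᵇ k))
        by-cases false = phase2-countF N p B′ k

    PrD≡PrS-correction : PrD N p B k ≡ PrS N p B k
                           - binom N k * (p ^ℚ (N ∸ k)) * ((1ℚ - p) ^ℚ k) * (q N b ^ℚ (N ∸ b))
                           + δ N k * (q N b ^ℚ (N ∸ b))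
    PrD≡PrS-correction = begin
        PrD N p B k
      ≡⟨ PrD≡∑<N ⟩
        X + Q * δ N k
      ≡⟨ solve 6 (λ X Q d C A P → X :+ Q :* d := X :+ Q :* (C :* A :* P) :- C :* P :* A :* Q :+ d :* Q)
           refl X Q (δ N k) (binom N k) ((1ℚ - p) ^ℚ k) (p ^ℚ (N ∸ k)) ⟩
        X + Q * binPmf N (1ℚ - p) p k - binom N k * (p ^ℚ (N ∸ k)) * ((1ℚ - p) ^ℚ k) * Q + δ N k * Q
      ≡⟨ cong (λ x → x - binom N k * (p ^ℚ (N ∸ k)) * ((1ℚ - p) ^ℚ k) * Q + δ N k * Q) (sym PrS≡∑<N) ⟩
        PrS N p B k - binom N k * (p ^ℚ (N ∸ k)) * ((1ℚ - p) ^ℚ k) * Q + δ N k * Q ∎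
      where
      open ≡-Reasoning
      X = ∑ N phase1-then-binomial
      Q = q N b ^ℚ (N ∸ b)

-- The identities are polynomial in p and also hold for b = 0.
proposition4p4 : (n : ℕ) → 2 ≤ n → (p : ℚ) → 0ℚ < p → p < 1ℚ →
  (b k : ℕ) → 1 ≤ b → b ≤ n → k ≤ n →
  (B : Colouring n) → countF B ≡ b →
  (PrS n p B k ≡ formula1 n p b k)
  × (PrS n p B k ≡ formula2 n p b k)
  × (PrD n p B k ≡ PrS n p B k
                   - binom n k * (p ^ℚ (n ∸ k)) * ((1ℚ - p) ^ℚ k) * (q n b ^ℚ (n ∸ b))
                   + δ n k * (q n b ^ℚ (n ∸ b)))
proposition4p4 (suc (suc m)) (s≤s (s≤s z≤n)) p _ _ .(countF B) k _ _ k≤n B refl =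
  PrS≡formula1 p k k≤n , PrS≡formula2 p k , PrD≡PrS-correction p k
  where open OnComplete m B
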